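{- Consider the Round-Robin protocol with $n$ agents over a finite item set $M$, as described in the context. Let $i\in[n]$ be an agent whose objective $f_i$ is normalized, nonnegative, monotone (non-decreasing) and submodular, and whose constraint $\mathcal{I}_i$ is a $p_i$-system. If agent $i$ follows the greedy policy (and the other agents follow arbitrary policies), then the set $S_i$ agent $i$ builds satisfies $f_i(S_i)\ge \mathrm{OPT}^-_i/(n+p_i)$.
   Context: Items: a finite set $M$ with $|M|=m$; agents $[n]=\{1,\dots,n\}$. For $f:2^M\to\mathbb{R}$ write $f(T\,|\,S)=f(T\cup S)-f(S)$ and $f(x\,|\,S)=f(\{x\}\,|\,S)$. $f$ is submodular if $f(x\,|\,S)\ge f(x\,|\,T)$ for all $S\subseteq T\subseteq M$, $x\notin T$. An independence system is a family $\mathcal{I}\subseteq 2^M$ with $\emptyset\in\mathcal{I}$ that is closed under taking subsets. A basis of $S\subseteq M$ is a maximal member of $\mathcal{I}$ contained in $S$; $\mathrm{ur}(S)$ and $\mathrm{lr}(S)$ are the largest and smallest cardinalities of a basis of $S$. A $p$-system is an independence system with $\max_{S\subseteq M}\mathrm{ur}(S)/\mathrm{lr}(S)\le p$. Round-Robin protocol: initially the set of available items is $Q=M$; for rounds $r=1,\dots,\lceil m/n\rceil$ and, within each round, for agents $i=1,\dots,n$ in this order, the current agent (according to its policy, which may depend on full information about all agents' objectives, constraints and choices so far) either selects one item of $Q$, which is then removed from $Q$, or selects nothing. Greedy policy of agent $i$: the agent maintains a set $S_i$ (initially $\emptyset$); at each of its turns, let $A=\{x\in Q: S_i\cup\{x\}\in\mathcal{I}_i\}$;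 if $A\ne\emptyset$, it selects some $j\in\arg\max_{x\in A} f_i(x\,|\,S_i)$ and adds $j$ to $S_i$; otherwise it selects nothing. Let $M_i$ be the set of items still available right before agent $i$'s first turn; $\mathrm{OPT}^-_i=\max\{f_i(S): S\in\mathcal{I}_i,\ S\subseteq M_i\}$.
   Formalization: The objective $f_i$ takes values in ℚ instead of ℝ, and the parameter $p_i$ is rational. -}

module Defs where

open import Data.Nat as ℕ using (ℕ; zero; suc; _∸_; NonZero)
open import Data.Nat.DivMod using (_/_)
open import Data.Fin using (Fin; toℕ)
open import Data.Fin.Subset using (Subset; ⊥; ∁; _∪_; ⁅_⁆; _∈_; _∉_; _⊆_; ∣_∣)
open import Data.Maybe using (Maybe; just; nothing)
open import Data.Integer using (+_)
open import Data.Rational as ℚ using (ℚ; 0ℚ)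
open import Data.Product using (Σ; _×_; ∃)
open import Data.Sum using (_⊎_)
open import Relation.Nullary using (¬_)
open import Relation.Binary.PropositionalEquality using (_≡_)

ℕtoℚ : ℕ → ℚ
ℕtoℚ k = ℚ._/_ (+ k) 1

⌈_/_⌉ : (a b : ℕ) → .{{NonZero b}} → ℕ
⌈ a / b ⌉ = (a ℕ.+ (b ∸ 1)) / b

-- Set functions on the item set M = Fin m  (values in ℚ)

SetFun : ℕ → Set
SetFun m = Subset m → ℚ

module _ {m : ℕ} where

  marg : SetFun m → Subset m → Subset m → ℚ
  marg f T S = f (T ∪ S) ℚ.- f S

  margₑ : SetFun m → Fin m → Subset m → ℚ
  margₑ f x S = marg f ⁅ x ⁆ S

  Normalized : SetFun m → Set
  Normalized f = f ⊥ ≡ 0ℚ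

  Nonnegative : SetFun m → Set
  Nonnegative f = ∀ S → 0ℚ ℚ.≤ f S

  Monotone : SetFun m → Set
  Monotone f = ∀ S T → S ⊆ T → f S ℚ.≤ f T

  Submodular : SetFun m → Set
  Submodular f = ∀ S T x → S ⊆ T → x ∉ T → margₑ f x T ℚ.≤ margₑ f x S

  record IndependenceSystem (I : Subset m → Set) : Set where
    field
      empty-indep : I ⊥
      down-closed : ∀ S T → T ⊆ S → I S → I T

  IsBasis : (Subset m → Set) → Subset m → Subset m → Set
  IsBasis I S B = B ⊆ S × I B × (∀ B′ → B ⊆ B′ → B′ ⊆ S → I B′ → B′ ⊆ B)

  -- p-system: independence system with ur(S)/lr(S) ≤ p for all S, i.e.
  -- |B| ≤ p·|B′| for any two bases B, B′ of any S (multiplicative form,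
  -- which also handles the case lr(S) = 0).
  IsPSystem : ℚ → (Subset m → Set) → Set
  IsPSystem p I = IndependenceSystem I ×
    (∀ S B B′ → IsBasis I S B → IsBasis I S B′ →
       ℕtoℚ ∣ B ∣ ℚ.≤ p ℚ.* ℕtoℚ ∣ B′ ∣)

-- Turns are numbered t = 0,1,2,… ; turn t = r·n + k (k < n) is the turn of
-- agent k in round r+1.  There are ⌈m/n⌉ rounds, i.e. ⌈m/n⌉·n turns.
-- An execution is recorded by the choice made at each turn:
-- `pick t = just x` (item x selected) or `pick t = nothing`.

Picks : ℕ → Set
Picks m = ℕ → Maybe (Fin m)

module _ {m : ℕ} where

  add : Maybe (Fin m) → Subset m → Subset m
  add nothing  S = S
  add (just x) S = S ∪ ⁅ x ⁆

  taken : Picks m → ℕ → Subset m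
  taken π zero    = ⊥
  taken π (suc t) = add (π t) (taken π t)

  avail : Picks m → ℕ → Subset m
  avail π t = ∁ (taken π t)

  Legal : Picks m → ℕ → Set
  Legal π T = ∀ t x → t ℕ.< T → π t ≡ just x → x ∈ avail π t

module _ {m n : ℕ} .{{_ : NonZero n}} where

  rounds : ℕ
  rounds = ⌈ m / n ⌉

  totalTurns : ℕ
  totalTurns = rounds ℕ.* n

  turnOf : Fin n → ℕ → ℕ
  turnOf i r = r ℕ.* n ℕ.+ toℕ i

  selectedBy : Picks m → Fin n → ℕ → Subset m
  selectedBy π i zero    = ⊥
  selectedBy π i (suc r) = add (π (turnOf i r)) (selectedBy π i r)

  GreedyStep : SetFun m → (Subset m → Set) → Picks m → Fin n → ℕ → Set
  GreedyStep f I π i r =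
    let t = turnOf i r
        S = selectedBy π i r
        Q = avail π t
    in (π t ≡ nothing × (∀ x → x ∈ Q → ¬ I (S ∪ ⁅ x ⁆)))
       ⊎ (Σ (Fin m) λ j → π t ≡ just j × j ∈ Q × I (S ∪ ⁅ j ⁆) ×
            (∀ x → x ∈ Q → I (S ∪ ⁅ x ⁆) → margₑ f x S ℚ.≤ margₑ f j S))

  Greedy : SetFun m → (Subset m → Set) → Picks m → Fin n → Set
  Greedy f I π i = ∀ r → r ℕ.< rounds → GreedyStep f I π i r

  Mᵢ : Picks m → Fin n → Subset m
  Mᵢ π i = avail π (toℕ i)

  finalSet : Picks m → Fin n → Subset m
  finalSet π i = selectedBy π i rounds

-- Let S r be agent i's set after r of its turns, R the number of rounds and
-- δ r = f (S (r+1)) − f (S r), so that Σ_{r<R} δ r = f (S R); the greedy choice together with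
-- submodularity makes δ non-increasing. Fix an independent O ⊆ Mᵢ and call o ∈ O ∖ S R closed
-- at round t once it is no longer both available and addable to S t. An item closing between
-- rounds t and t+1 was open at round t, so f(o | S R) ≤ f(o | S t) ≤ δ t. An item closed at
-- round t was either taken by one of the other n − 1 agents (at most (n − 1) t items) or cannot
-- be added to S t; the latter form an independent set no element of which extends S t, so there
-- are at most p |S t| ≤ p t of them. Summation by parts against the non-increasing δ gives
-- Σ_{o ∈ O ∖ S R} f(o | S R) ≤ (n − 1 + p) f(S R), and submodularity bounds f(O) by f(S R) plus
-- that sum.
-- The independence predicate need not be decidable, but the final inequality is, so a decision
-- procedure for it may be assumed: one exists up to double negation.

module Submission where

open import Defs
open import Data.Nat as ℕ using (ℕ; zero; suc; NonZero; z≤n; s≤s)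
import Data.Nat.Properties as ℕP
import Data.Nat.DivMod as ℕD
open import Data.Integer as ℤ using (+_)
import Data.Integer.Properties as ℤP
open import Data.Bool using (true)
open import Data.Fin using (Fin; zero; suc; toℕ; _≟_)
import Data.Fin.Properties as FinP
open import Data.Fin.Subset
  using (Subset; ⊥; ∁; _∪_; _─_; ⁅_⁆; _∈_; _∉_; _⊆_; ∣_∣; Empty; inside; outside)
import Data.Fin.Subset.Properties as SubP
open import Data.Vec using ([]; _∷_; here; there; tabulate)
import Data.Vec.Properties as VecP
open import Data.Maybe using (Maybe; just; nothing)
open import Data.Rational as ℚ using (ℚ; 0ℚ; 1ℚ; _+_; _*_; _-_; _≤_; _≤?_)
import Data.Rational.Properties as ℚP
import Data.Rational.Unnormalised as ℚᵘ
import Data.Rational.Unnormalised.Properties as ℚᵘP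
open import Data.Rational.Solver using (module +-*-Solver)
open import Data.Product using (_×_; _,_; proj₁; proj₂; ∃)
open import Data.Sum using (_⊎_; inj₁; inj₂; [_,_]; map₂)
open import Data.Empty using (⊥-elim)
open import Function using (_∘_; id)
open import Relation.Nullary using (¬_; Dec; yes; no; does; ¬?; _×-dec_)
open import Relation.Nullary.Decidable using (decidable-stable; dec-true; ¬¬-excluded-middle)
open import Relation.Unary using (Decidable)
open import Relation.Binary.PropositionalEquality
  using (_≡_; refl; sym; trans; cong; cong₂; subst; subst₂; module ≡-Reasoning)

open +-*-Solver

ι : ℕ → ℚᵘ.ℚᵘ
ι k = ℚᵘ.mkℚᵘ (+ k) 0

toℚᵘ-ℕtoℚ : ∀ k → ℚ.toℚᵘ (ℕtoℚ k) ℚᵘ.≃ ι k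
toℚᵘ-ℕtoℚ k = ℚP.toℚᵘ-fromℚᵘ (ι k)

ι-+ : ∀ a b → ι (a ℕ.+ b) ℚᵘ.≃ ι a ℚᵘ.+ ι b
ι-+ a b = ℚᵘ.*≡* (begin
  + (a ℕ.+ b) ℤ.* + 1                 ≡⟨ ℤP.*-identityʳ _ ⟩
  + (a ℕ.+ b)                         ≡⟨ ℤP.pos-+ a b ⟩
  + a ℤ.+ + b                         ≡⟨ sym (cong₂ ℤ._+_ (ℤP.*-identityʳ (+ a)) (ℤP.*-identityʳ (+ b))) ⟩
  + a ℤ.* + 1 ℤ.+ + b ℤ.* + 1         ≡⟨ sym (ℤP.*-identityʳ _) ⟩
  (+ a ℤ.* + 1 ℤ.+ + b ℤ.* + 1) ℤ.* + 1 ∎)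
  where open ≡-Reasoning

ι-* : ∀ a b → ι (a ℕ.* b) ℚᵘ.≃ ι a ℚᵘ.* ι b
ι-* a b = ℚᵘ.*≡* (begin
  + (a ℕ.* b) ℤ.* + 1   ≡⟨ ℤP.*-identityʳ _ ⟩
  + (a ℕ.* b)           ≡⟨ ℤP.pos-* a b ⟩
  + a ℤ.* + b           ≡⟨ sym (ℤP.*-identityʳ _) ⟩
  (+ a ℤ.* + b) ℤ.* + 1 ∎)
  where open ≡-Reasoning

ℕtoℚ-+ : ∀ a b → ℕtoℚ (a ℕ.+ b) ≡ ℕtoℚ a + ℕtoℚ b
ℕtoℚ-+ a b = ℚP.toℚᵘ-injective (begin
  ℚ.toℚᵘ (ℕtoℚ (a ℕ.+ b))                ≈⟨ toℚᵘ-ℕtoℚ (a ℕ.+ b) ⟩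
  ι (a ℕ.+ b)                            ≈⟨ ι-+ a b ⟩
  ι a ℚᵘ.+ ι b                           ≈⟨ ℚᵘP.+-cong (toℚᵘ-ℕtoℚ a) (toℚᵘ-ℕtoℚ b) ⟨
  ℚ.toℚᵘ (ℕtoℚ a) ℚᵘ.+ ℚ.toℚᵘ (ℕtoℚ b)   ≈⟨ ℚP.toℚᵘ-homo-+ (ℕtoℚ a) (ℕtoℚ b) ⟨
  ℚ.toℚᵘ (ℕtoℚ a + ℕtoℚ b)               ∎)
  where open ℚᵘP.≃-Reasoning

ℕtoℚ-* : ∀ a b → ℕtoℚ (a ℕ.* b) ≡ ℕtoℚ a * ℕtoℚ b
ℕtoℚ-* a b = ℚP.toℚᵘ-injective (begin
  ℚ.toℚᵘ (ℕtoℚ (a ℕ.* b))                ≈⟨ toℚᵘ-ℕtoℚ (a ℕ.* b) ⟩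
  ι (a ℕ.* b)                            ≈⟨ ι-* a b ⟩
  ι a ℚᵘ.* ι b                           ≈⟨ ℚᵘP.*-cong (toℚᵘ-ℕtoℚ a) (toℚᵘ-ℕtoℚ b) ⟨
  ℚ.toℚᵘ (ℕtoℚ a) ℚᵘ.* ℚ.toℚᵘ (ℕtoℚ b)   ≈⟨ ℚP.toℚᵘ-homo-* (ℕtoℚ a) (ℕtoℚ b) ⟨
  ℚ.toℚᵘ (ℕtoℚ a * ℕtoℚ b)               ∎)
  where open ℚᵘP.≃-Reasoning

ℕtoℚ-suc : ∀ k → ℕtoℚ (suc k) ≡ 1ℚ + ℕtoℚ k
ℕtoℚ-suc = ℕtoℚ-+ 1

ℕtoℚ-mono-≤ : ∀ {a b} → a ℕ.≤ b → ℕtoℚ a ≤ ℕtoℚ b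
ℕtoℚ-mono-≤ {a} {b} a≤b = ℚP.toℚᵘ-cancel-≤
  (ℚᵘP.≤-respʳ-≃ (ℚᵘP.≃-sym (toℚᵘ-ℕtoℚ b)) (ℚᵘP.≤-respˡ-≃ (ℚᵘP.≃-sym (toℚᵘ-ℕtoℚ a))
    (ℚᵘ.*≤* (ℤP.*-monoʳ-≤-nonNeg (+ 1) (ℤ.+≤+ a≤b)))))

p≤q⇒0≤q-p : ∀ {p q} → p ≤ q → 0ℚ ≤ q - p
p≤q⇒0≤q-p {p} p≤q = ℚP.≤-trans (ℚP.≤-reflexive (sym (ℚP.+-inverseʳ p))) (ℚP.+-monoˡ-≤ (ℚ.- p) p≤q)

*-monoˡ-≤-0≤ : ∀ {r p q} → 0ℚ ≤ r → p ≤ q → r * p ≤ r * q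
*-monoˡ-≤-0≤ {r} 0≤r = ℚP.*-monoˡ-≤-nonNeg r {{ℚ.nonNegative 0≤r}}

m≤⌈m/n⌉*n : ∀ m n → m ℕ.≤ ⌈ m / suc n ⌉ ℕ.* suc n
m≤⌈m/n⌉*n m n = ℕP.+-cancelˡ-≤ n m (⌈ m / suc n ⌉ ℕ.* suc n) (begin
  n ℕ.+ m                                   ≡⟨ ℕP.+-comm n m ⟩
  m ℕ.+ n                                   ≡⟨ ℕD.m≡m%n+[m/n]*n (m ℕ.+ n) (suc n) ⟩
  (m ℕ.+ n) ℕD.% suc n ℕ.+ ⌈ m / suc n ⌉ ℕ.* suc n
    ≤⟨ ℕP.+-monoˡ-≤ _ (ℕP.≤-pred (ℕD.m%n<n (m ℕ.+ n) (suc n))) ⟩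
  n ℕ.+ ⌈ m / suc n ⌉ ℕ.* suc n             ∎)
  where open ℕP.≤-Reasoning

prefixSum : (ℕ → ℚ) → ℕ → ℚ
prefixSum g zero    = 0ℚ
prefixSum g (suc t) = prefixSum g t + g t

prefixSum-telescope : ∀ (g : ℕ → ℚ) t → prefixSum (λ s → g (suc s) - g s) t ≡ g t - g 0
prefixSum-telescope g zero    = sym (ℚP.+-inverseʳ (g 0))
prefixSum-telescope g (suc t) = trans (cong (_+ (g (suc t) - g t)) (prefixSum-telescope g t))
  (solve 3 (λ a b c → (a :- c) :+ (b :- a) := b :- c) refl (g t) (g (suc t)) (g 0))

-- Summation by parts; the step hypothesis says a (1+t) − a t ≤ (N (1+t) − N t) · δ t.
abel-bound : ∀ (R : ℕ) (K : ℚ) (a N δ : ℕ → ℚ) → a 0 ≡ 0ℚ → N 0 ≡ 0ℚ →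
  (∀ t → t ℕ.< R → a (suc t) + N t * δ t ≤ a t + N (suc t) * δ t) →
  (∀ t → t ℕ.≤ R → N t ≤ K * ℕtoℚ t) →
  (∀ s t → s ℕ.≤ t → t ℕ.< R → δ t ≤ δ s) →
  (∀ t → t ℕ.< R → 0ℚ ≤ δ t) →
  a R ≤ K * prefixSum δ R
abel-bound R K a N δ a0 N0 step N≤Kt δ-antitone δ-nonneg = begin
  a R                                ≡⟨ solve 3 (λ x u v → x := x :+ (u :- v) :* con 0ℚ) refl (a R) (B R) (N R) ⟩
  a R + (B R - N R) * 0ℚ             ≤⟨ invariant R ℕP.≤-refl 0ℚ δ-nonneg ⟩
  K * prefixSum δ R                  ∎
  where
  open ℚP.≤-Reasoning
  B : ℕ → ℚ
  B t = K * ℕtoℚ t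

  B-suc : ∀ t → B (suc t) ≡ B t + K
  B-suc t = trans (cong (K *_) (ℕtoℚ-suc t))
    (solve 2 (λ k x → k :* (con 1ℚ :+ x) := k :* x :+ k) refl K (ℕtoℚ t))

  -- The unused budget B t − N t, priced at any lower bound y of the δ s spent so far.
  invariant : ∀ t → t ℕ.≤ R → ∀ y → (∀ s → s ℕ.< t → y ≤ δ s) →
              a t + (B t - N t) * y ≤ K * prefixSum δ t
  invariant zero _ y _ = ℚP.≤-reflexive (begin-equality
    a 0 + (B 0 - N 0) * y    ≡⟨ cong₂ (λ u v → u + (B 0 - v) * y) a0 N0 ⟩
    0ℚ + (B 0 - 0ℚ) * y      ≡⟨ solve 2 (λ k y → con 0ℚ :+ (k :* con 0ℚ :- con 0ℚ) :* y := k :* con 0ℚ) refl K y ⟩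
    K * 0ℚ                   ∎)
  invariant (suc t) t<R y y≤δ = begin
    a (suc t) + (B (suc t) - N (suc t)) * y
      ≤⟨ ℚP.+-monoʳ-≤ (a (suc t)) (*-monoˡ-≤-0≤ (p≤q⇒0≤q-p (N≤Kt (suc t) t<R)) (y≤δ t (ℕP.n<1+n t))) ⟩
    a (suc t) + (B (suc t) - N (suc t)) * δ t
      ≡⟨ cong (λ u → a (suc t) + (u - N (suc t)) * δ t) (B-suc t) ⟩
    a (suc t) + (B t + K - N (suc t)) * δ t
      ≡⟨ solve 6 (λ a₁ n d b k n₁ → a₁ :+ (b :+ k :- n₁) :* d := (a₁ :+ n :* d) :+ (b :+ k :- n₁ :- n) :* d)
           refl (a (suc t)) (N t) (δ t) (B t) K (N (suc t)) ⟩
    (a (suc t) + N t * δ t) + (B t + K - N (suc t) - N t) * δ t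
      ≤⟨ ℚP.+-monoˡ-≤ _ (step t t<R) ⟩
    (a t + N (suc t) * δ t) + (B t + K - N (suc t) - N t) * δ t
      ≡⟨ solve 6 (λ a₀ n₁ d b k n → (a₀ :+ n₁ :* d) :+ (b :+ k :- n₁ :- n) :* d := (a₀ :+ (b :- n) :* d) :+ k :* d)
           refl (a t) (N (suc t)) (δ t) (B t) K (N t) ⟩
    (a t + (B t - N t) * δ t) + K * δ t
      ≤⟨ ℚP.+-monoˡ-≤ _ (invariant t (ℕP.<⇒≤ t<R) (δ t) (λ s s<t → δ-antitone s t (ℕP.<⇒≤ s<t) t<R)) ⟩
    K * prefixSum δ t + K * δ t
      ≡⟨ ℚP.*-distribˡ-+ K (prefixSum δ t) (δ t) ⟨
    K * prefixSum δ (suc t) ∎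

module _ {k : ℕ} where

  ∪-lub : ∀ {A B C : Subset k} → A ⊆ C → B ⊆ C → A ∪ B ⊆ C
  ∪-lub {A} {B} A⊆C B⊆C x∈A∪B = [ A⊆C , B⊆C ] (SubP.x∈p∪q⁻ A B x∈A∪B)

  ∪-monoˡ-⊆ : ∀ {A B : Subset k} (C : Subset k) → A ⊆ B → A ∪ C ⊆ B ∪ C
  ∪-monoˡ-⊆ {B = B} C A⊆B = ∪-lub (SubP.p⊆p∪q C ∘ A⊆B) (SubP.q⊆p∪q B C)

  x∈p⇒⁅x⁆⊆p : ∀ {x : Fin k} {A : Subset k} → x ∈ A → ⁅ x ⁆ ⊆ A
  x∈p⇒⁅x⁆⊆p {x} x∈A y∈⁅x⁆ rewrite SubP.x∈⁅y⁆⇒x≡y x y∈⁅x⁆ = x∈A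

  x∉p⇒∣p∣<∣p∪⁅x⁆∣ : ∀ {x : Fin k} (A : Subset k) → x ∉ A → ∣ A ∣ ℕ.< ∣ A ∪ ⁅ x ⁆ ∣
  x∉p⇒∣p∣<∣p∪⁅x⁆∣ {x} A x∉A =
    SubP.p⊂q⇒∣p∣<∣q∣ (SubP.p⊆p∪q ⁅ x ⁆ , x , SubP.x∈p∪q⁺ (inj₂ (SubP.x∈⁅x⁆ x)) , x∉A)

  x∈p⇒p≡⁅x⁆∪p-x : ∀ {x : Fin k} {A : Subset k} → x ∈ A → A ≡ ⁅ x ⁆ ∪ (A ─ ⁅ x ⁆)
  x∈p⇒p≡⁅x⁆∪p-x {x} {A} x∈A = SubP.⊆-antisym split (∪-lub (x∈p⇒⁅x⁆⊆p x∈A) (SubP.p─q⊆p A ⁅ x ⁆))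
    where
    split : A ⊆ ⁅ x ⁆ ∪ (A ─ ⁅ x ⁆)
    split {y} y∈A with y ≟ x
    ... | yes refl = SubP.x∈p∪q⁺ (inj₁ (SubP.x∈⁅x⁆ x))
    ... | no y≢x   = SubP.x∈p∪q⁺ (inj₂ (SubP.x∈p∧x≢y⇒x∈p-y y∈A y≢x))

x∈p─q⇒x∉q : ∀ {k} {x : Fin k} (A B : Subset k) → x ∈ A ─ B → x ∉ B
x∈p─q⇒x∉q (inside ∷ A) (outside ∷ B) here       ()
x∈p─q⇒x∉q (_ ∷ A)      (_ ∷ B)       (there x∈) (there x∈B) = x∈p─q⇒x∉q A B x∈ x∈B

∣p∪q∣≤∣p∣+∣q∣ : ∀ {k} (A B : Subset k) → ∣ A ∪ B ∣ ℕ.≤ ∣ A ∣ ℕ.+ ∣ B ∣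
∣p∪q∣≤∣p∣+∣q∣ []            []            = z≤n
∣p∪q∣≤∣p∣+∣q∣ (inside ∷ A)  (inside ∷ B)  =
  s≤s (ℕP.≤-trans (∣p∪q∣≤∣p∣+∣q∣ A B) (ℕP.+-monoʳ-≤ ∣ A ∣ (ℕP.n≤1+n ∣ B ∣)))
∣p∪q∣≤∣p∣+∣q∣ (inside ∷ A)  (outside ∷ B) = s≤s (∣p∪q∣≤∣p∣+∣q∣ A B)
∣p∪q∣≤∣p∣+∣q∣ (outside ∷ A) (inside ∷ B)  =
  ℕP.≤-trans (s≤s (∣p∪q∣≤∣p∣+∣q∣ A B)) (ℕP.≤-reflexive (sym (ℕP.+-suc ∣ A ∣ ∣ B ∣)))
∣p∪q∣≤∣p∣+∣q∣ (outside ∷ A) (outside ∷ B) = ∣p∪q∣≤∣p∣+∣q∣ A B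

∣p∪⁅x⁆∣≤1+∣p∣ : ∀ {k} (A : Subset k) (x : Fin k) → ∣ A ∪ ⁅ x ⁆ ∣ ℕ.≤ suc ∣ A ∣
∣p∪⁅x⁆∣≤1+∣p∣ A x = ℕP.≤-trans (∣p∪q∣≤∣p∣+∣q∣ A ⁅ x ⁆)
  (ℕP.≤-reflexive (trans (cong (∣ A ∣ ℕ.+_) (SubP.∣⁅x⁆∣≡1 x)) (ℕP.+-comm ∣ A ∣ 1)))

filterSubset : ∀ {k} {P : Fin k → Set} → Decidable P → Subset k
filterSubset P? = tabulate (does ∘ P?)

∈-filterSubset⁺ : ∀ {k} {P : Fin k → Set} (P? : Decidable P) {x} → P x → x ∈ filterSubset P?
∈-filterSubset⁺ P? {x} px = VecP.lookup⇒[]= x _ (trans (VecP.lookup∘tabulate _ x) (dec-true (P? x) px))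

∈-filterSubset⁻ : ∀ {k} {P : Fin k → Set} (P? : Decidable P) {x} → x ∈ filterSubset P? → P x
∈-filterSubset⁻ {P = P} P? {x} x∈ =
  from-does (P? x) (trans (sym (VecP.lookup∘tabulate (does ∘ P?) x)) (VecP.[]=⇒lookup x∈))
  where
  from-does : (d : Dec (P x)) → does d ≡ true → P x
  from-does (yes px) _ = px

¬¬-decidable : ∀ {k} (P : Subset k → Set) → ¬ ¬ Decidable P
¬¬-decidable {zero}  P ¬P? = ¬¬-excluded-middle λ P[]? → ¬P? λ { [] → P[]? }
¬¬-decidable {suc k} P ¬P? =
  ¬¬-decidable (P ∘ (inside ∷_)) λ Pin? →
  ¬¬-decidable (P ∘ (outside ∷_)) λ Pout? →
  ¬P? λ { (inside ∷ A) → Pin? A ; (outside ∷ A) → Pout? A }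

sumOver : ∀ {k} → Subset k → (Fin k → ℚ) → ℚ
sumOver []            v = 0ℚ
sumOver (inside ∷ A)  v = v zero + sumOver A (v ∘ suc)
sumOver (outside ∷ A) v = sumOver A (v ∘ suc)

sumOver-⊥ : ∀ {k} (v : Fin k → ℚ) → sumOver ⊥ v ≡ 0ℚ
sumOver-⊥ {zero}  v = refl
sumOver-⊥ {suc k} v = sumOver-⊥ (v ∘ suc)

sumOver-remove : ∀ {k} {x : Fin k} (A : Subset k) (v : Fin k → ℚ) → x ∈ A →
                 sumOver A v ≡ v x + sumOver (A ─ ⁅ x ⁆) v
sumOver-remove (inside ∷ A) v here = cong (_+_ (v zero)) (cong (λ B → sumOver B (v ∘ suc)) (sym (SubP.p─⊥≡p A)))
sumOver-remove {x = suc x} (inside ∷ A) v (there x∈A) =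
  trans (cong (_+_ (v zero)) (sumOver-remove A (v ∘ suc) x∈A))
        (solve 3 (λ a b c → a :+ (b :+ c) := b :+ (a :+ c))
               refl (v zero) (v (suc x)) (sumOver (A ─ ⁅ x ⁆) (v ∘ suc)))
sumOver-remove (outside ∷ A) v (there x∈A) = sumOver-remove A (v ∘ suc) x∈A

sumOver-⊆-bound : ∀ {k} (A B : Subset k) (v : Fin k → ℚ) (c : ℚ) → A ⊆ B →
  (∀ {x} → x ∈ B ─ A → v x ≤ c) →
  sumOver B v + ℕtoℚ ∣ A ∣ * c ≤ sumOver A v + ℕtoℚ ∣ B ∣ * c
sumOver-⊆-bound []            []            v c _ _ = ℚP.≤-refl
sumOver-⊆-bound (inside ∷ A)  (outside ∷ B) v c A⊆B _ with () ← A⊆B here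
sumOver-⊆-bound (inside ∷ A)  (inside ∷ B)  v c A⊆B v≤c = begin
  v zero + sumOver B _ + ℕtoℚ (suc ∣ A ∣) * c   ≡⟨ cong (λ u → v zero + sumOver B _ + u * c) (ℕtoℚ-suc ∣ A ∣) ⟩
  v zero + sumOver B _ + (1ℚ + ℕtoℚ ∣ A ∣) * c
    ≡⟨ solve 4 (λ a b n c → a :+ b :+ (con 1ℚ :+ n) :* c := (a :+ c) :+ (b :+ n :* c))
               refl (v zero) (sumOver B _) (ℕtoℚ ∣ A ∣) c ⟩
  (v zero + c) + (sumOver B _ + ℕtoℚ ∣ A ∣ * c)
    ≤⟨ ℚP.+-monoʳ-≤ (v zero + c) (sumOver-⊆-bound A B (v ∘ suc) c (SubP.drop-∷-⊆ A⊆B) (v≤c ∘ there)) ⟩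
  (v zero + c) + (sumOver A _ + ℕtoℚ ∣ B ∣ * c)
    ≡⟨ solve 4 (λ a b n c → (a :+ c) :+ (b :+ n :* c) := a :+ b :+ (con 1ℚ :+ n) :* c)
               refl (v zero) (sumOver A _) (ℕtoℚ ∣ B ∣) c ⟩
  v zero + sumOver A _ + (1ℚ + ℕtoℚ ∣ B ∣) * c  ≡⟨ cong (λ u → v zero + sumOver A _ + u * c) (ℕtoℚ-suc ∣ B ∣) ⟨
  v zero + sumOver A _ + ℕtoℚ (suc ∣ B ∣) * c   ∎
  where open ℚP.≤-Reasoning
sumOver-⊆-bound (outside ∷ A) (inside ∷ B)  v c A⊆B v≤c = begin
  v zero + sumOver B _ + ℕtoℚ ∣ A ∣ * c         ≡⟨ ℚP.+-assoc (v zero) (sumOver B _) _ ⟩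
  v zero + (sumOver B _ + ℕtoℚ ∣ A ∣ * c)
    ≤⟨ ℚP.+-mono-≤ (v≤c here) (sumOver-⊆-bound A B (v ∘ suc) c (SubP.drop-∷-⊆ A⊆B) (v≤c ∘ there)) ⟩
  c + (sumOver A _ + ℕtoℚ ∣ B ∣ * c)
    ≡⟨ solve 3 (λ b n c → c :+ (b :+ n :* c) := b :+ (con 1ℚ :+ n) :* c) refl (sumOver A _) (ℕtoℚ ∣ B ∣) c ⟩
  sumOver A _ + (1ℚ + ℕtoℚ ∣ B ∣) * c           ≡⟨ cong (λ u → sumOver A _ + u * c) (ℕtoℚ-suc ∣ B ∣) ⟨
  sumOver A _ + ℕtoℚ (suc ∣ B ∣) * c            ∎
  where open ℚP.≤-Reasoning
sumOver-⊆-bound (outside ∷ A) (outside ∷ B) v c A⊆B v≤c =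
  sumOver-⊆-bound A B (v ∘ suc) c (SubP.drop-∷-⊆ A⊆B) (v≤c ∘ there)

-- Submodular functions and p-systems

module _ {m : ℕ} {f : SetFun m} (submodular : Submodular f) where

  submodular-∪-bound : ∀ (A S : Subset m) → (∀ {x} → x ∈ A → x ∉ S) →
                       f (A ∪ S) ≤ f S + sumOver A (λ x → margₑ f x S)
  submodular-∪-bound A S = bound ∣ A ∣ A ℕP.≤-refl
    where
    v : Fin m → ℚ
    v x = margₑ f x S

    bound : ∀ c A → ∣ A ∣ ℕ.≤ c → (∀ {x} → x ∈ A → x ∉ S) → f (A ∪ S) ≤ f S + sumOver A v
    bound c A ∣A∣≤c disjoint with SubP.nonempty? A
    ... | no empty rewrite SubP.Empty-unique empty | SubP.∪-identityˡ S | sumOver-⊥ v =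
      ℚP.≤-reflexive (sym (ℚP.+-identityʳ (f S)))
    bound zero    A ∣A∣≤0 disjoint | yes (x , x∈A) = ⊥-elim (ℕP.n≮0 (ℕP.<-≤-trans (SubP.x∈p⇒∣p-x∣<∣p∣ x∈A) ∣A∣≤0))
    bound (suc c) A ∣A∣≤c disjoint | yes (x , x∈A) = begin
      f (A ∪ S)                    ≡⟨ cong (λ B → f (B ∪ S)) (x∈p⇒p≡⁅x⁆∪p-x x∈A) ⟩
      f ((⁅ x ⁆ ∪ A′) ∪ S)         ≡⟨ cong f (SubP.∪-assoc ⁅ x ⁆ A′ S) ⟩
      f (⁅ x ⁆ ∪ T)                ≡⟨ solve 2 (λ a b → a := b :+ (a :- b)) refl (f (⁅ x ⁆ ∪ T)) (f T) ⟩
      f T + margₑ f x T            ≤⟨ ℚP.+-mono-≤ rest-bound (submodular S T x (SubP.q⊆p∪q A′ S) x∉T) ⟩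
      (f S + sumOver A′ v) + v x   ≡⟨ ℚP.+-assoc (f S) (sumOver A′ v) (v x) ⟩
      f S + (sumOver A′ v + v x)   ≡⟨ cong (_+_ (f S)) (ℚP.+-comm (sumOver A′ v) (v x)) ⟩
      f S + (v x + sumOver A′ v)   ≡⟨ cong (_+_ (f S)) (sumOver-remove A v x∈A) ⟨
      f S + sumOver A v            ∎
      where
      open ℚP.≤-Reasoning
      A′ T : Subset m
      A′ = A ─ ⁅ x ⁆
      T  = A′ ∪ S
      rest-bound : f T ≤ f S + sumOver A′ v
      rest-bound = bound c A′ (ℕP.≤-pred (ℕP.<-≤-trans (SubP.x∈p⇒∣p-x∣<∣p∣ x∈A) ∣A∣≤c))
                         (disjoint ∘ SubP.p─q⊆p A ⁅ x ⁆)
      x∉T : x ∉ T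
      x∉T x∈T = [ (λ x∈A′ → x∈p─q⇒x∉q A ⁅ x ⁆ x∈A′ (SubP.x∈⁅x⁆ x)) , disjoint x∈A ] (SubP.x∈p∪q⁻ A′ S x∈T)

module _ {m : ℕ} {I : Subset m → Set} where

  extend-to-basis : IndependenceSystem I → Decidable I → ∀ (U B : Subset m) → B ⊆ U → I B →
                    ∃ λ B′ → B ⊆ B′ × IsBasis I U B′
  extend-to-basis indep I? U B B⊆U iB = extend ∣ U ∣ B B⊆U iB (ℕP.m≤m+n ∣ U ∣ ∣ B ∣)
    where
    open IndependenceSystem indep
    extend : ∀ fuel B → B ⊆ U → I B → ∣ U ∣ ℕ.≤ fuel ℕ.+ ∣ B ∣ → ∃ λ B′ → B ⊆ B′ × IsBasis I U B′
    extend fuel B B⊆U iB ∣U∣≤ with FinP.any? (λ x → (x SubP.∈? U) ×-dec (¬? (x SubP.∈? B) ×-dec I? (B ∪ ⁅ x ⁆)))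
    ... | no no-extension = B , id , B⊆U , iB , maximal
      where
      maximal : ∀ B′ → B ⊆ B′ → B′ ⊆ U → I B′ → B′ ⊆ B
      maximal B′ B⊆B′ B′⊆U iB′ {y} y∈B′ with y SubP.∈? B
      ... | yes y∈B = y∈B
      ... | no y∉B  = ⊥-elim (no-extension (y , B′⊆U y∈B′ , y∉B ,
                       down-closed B′ (B ∪ ⁅ y ⁆) (∪-lub B⊆B′ (x∈p⇒⁅x⁆⊆p y∈B′)) iB′))
    ... | yes (x , x∈U , x∉B , iBx) with B∪x⊆U ← ∪-lub B⊆U (x∈p⇒⁅x⁆⊆p x∈U) | fuel
    ...   | zero     = ⊥-elim (ℕP.<-irrefl refl
                         (ℕP.<-≤-trans (ℕP.≤-<-trans ∣U∣≤ (x∉p⇒∣p∣<∣p∪⁅x⁆∣ B x∉B))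
                                      (SubP.p⊆q⇒∣p∣≤∣q∣ B∪x⊆U)))
    ...   | suc fuel with B′ , B∪x⊆B′ , basis ← extend fuel (B ∪ ⁅ x ⁆) B∪x⊆U iBx
                (ℕP.≤-trans ∣U∣≤ (ℕP.≤-trans (ℕP.≤-reflexive (sym (ℕP.+-suc fuel ∣ B ∣)))
                                 (ℕP.+-monoʳ-≤ fuel (x∉p⇒∣p∣<∣p∪⁅x⁆∣ B x∉B))))
      = B′ , B∪x⊆B′ ∘ SubP.p⊆p∪q ⁅ x ⁆ , basis

  -- S is a basis of S ∪ Y, and Y extends to another one.
  p-system-bound : ∀ p → IsPSystem p I → Decidable I → ∀ {S Y} → I S → I Y →
                   (∀ {y} → y ∈ Y → ¬ I (S ∪ ⁅ y ⁆)) → ℕtoℚ ∣ Y ∣ ≤ p * ℕtoℚ ∣ S ∣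
  p-system-bound p (indep , ratio) I? {S} {Y} iS iY blocked
    with B , Y⊆B , basis-B ← extend-to-basis indep I? (S ∪ Y) Y (SubP.q⊆p∪q S Y) iY =
    ℚP.≤-trans (ℕtoℚ-mono-≤ (SubP.p⊆q⇒∣p∣≤∣q∣ Y⊆B)) (ratio (S ∪ Y) B S basis-B basis-S)
    where
    open IndependenceSystem indep
    basis-S : IsBasis I (S ∪ Y) S
    basis-S = SubP.p⊆p∪q Y , iS , λ B′ S⊆B′ B′⊆S∪Y iB′ {y} y∈B′ →
      [ id , (λ y∈Y → ⊥-elim (blocked y∈Y (down-closed B′ _ (∪-lub S⊆B′ (x∈p⇒⁅x⁆⊆p y∈B′)) iB′))) ]
        (SubP.x∈p∪q⁻ S Y (B′⊆S∪Y y∈B′))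

  p-system-degenerate : ∀ p → IsPSystem p I → ¬ (0ℚ ≤ p) → ∀ {X} → I X → X ≡ ⊥
  p-system-degenerate p (indep , ratio) p≱0 {X} iX = SubP.Empty-unique λ (x , x∈X) →
    p≱0 (ℚP.≤-trans (ℚP.nonNegative⁻¹ 1ℚ) (1≤p x (down-closed X ⁅ x ⁆ (x∈p⇒⁅x⁆⊆p x∈X) iX)))
    where
    open IndependenceSystem indep
    1≤p : ∀ x → I ⁅ x ⁆ → 1ℚ ≤ p
    1≤p x ix = subst₂ _≤_ (cong ℕtoℚ (SubP.∣⁅x⁆∣≡1 x))
      (trans (cong (λ k → p * ℕtoℚ k) (SubP.∣⁅x⁆∣≡1 x)) (ℚP.*-identityʳ p))
      (ratio ⁅ x ⁆ ⁅ x ⁆ ⁅ x ⁆ singleton-basis singleton-basis)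
      where
      singleton-basis : IsBasis I ⁅ x ⁆ ⁅ x ⁆
      singleton-basis = id , ix , λ _ _ B′⊆⁅x⁆ _ → B′⊆⁅x⁆

-- Executions of the protocol

module _ {m : ℕ} where

  ⊆-chain : ∀ (X : ℕ → Subset m) → (∀ r → X r ⊆ X (suc r)) → ∀ {r s} → r ℕ.≤ s → X r ⊆ X s
  ⊆-chain X step {s = zero}  z≤n = id
  ⊆-chain X step {s = suc s} r≤1+s with ℕP.m≤n⇒m<n∨m≡n r≤1+s
  ... | inj₁ r<1+s = step s ∘ ⊆-chain X step (ℕP.≤-pred r<1+s)
  ... | inj₂ refl  = id

  ⊆-add : ∀ (mx : Maybe (Fin m)) S → S ⊆ add mx S
  ⊆-add nothing  S = id
  ⊆-add (just x) S = SubP.p⊆p∪q ⁅ x ⁆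

  ∈-add-just : ∀ (x : Fin m) S → x ∈ add (just x) S
  ∈-add-just x S = SubP.x∈p∪q⁺ (inj₂ (SubP.x∈⁅x⁆ x))

  ∈-add⁻ : ∀ (mx : Maybe (Fin m)) S {y} → y ∈ add mx S → y ∈ S ⊎ mx ≡ just y
  ∈-add⁻ nothing  S y∈ = inj₁ y∈
  ∈-add⁻ (just x) S y∈ =
    map₂ (λ y∈⁅x⁆ → cong just (sym (SubP.x∈⁅y⁆⇒x≡y x y∈⁅x⁆))) (SubP.x∈p∪q⁻ S ⁅ x ⁆ y∈)

  add-mono : ∀ (mx : Maybe (Fin m)) {A B} → A ⊆ B → add mx A ⊆ add mx B
  add-mono mx {A} {B} A⊆B y∈ with ∈-add⁻ mx A y∈
  ... | inj₁ y∈A  = ⊆-add mx B (A⊆B y∈A)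
  ... | inj₂ refl = ∈-add-just _ B

  ∣add∣≤1+∣p∣ : ∀ (mx : Maybe (Fin m)) S → ∣ add mx S ∣ ℕ.≤ suc ∣ S ∣
  ∣add∣≤1+∣p∣ nothing  S = ℕP.n≤1+n ∣ S ∣
  ∣add∣≤1+∣p∣ (just x) S = ∣p∪⁅x⁆∣≤1+∣p∣ S x

  add-─-⊆ : ∀ (mx : Maybe (Fin m)) T E → add mx T ─ E ⊆ add mx (T ─ E)
  add-─-⊆ mx T E y∈ with ∈-add⁻ mx T (SubP.p─q⊆p (add mx T) E y∈)
  ... | inj₁ y∈T  = ⊆-add mx (T ─ E) (SubP.x∈p∧x∉q⇒x∈p─q y∈T (x∈p─q⇒x∉q (add mx T) E y∈))
  ... | inj₂ refl = ∈-add-just _ (T ─ E)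

  add-─-add-⊆ : ∀ (mx : Maybe (Fin m)) T E S → add mx T ─ (E ∪ add mx S) ⊆ T ─ (E ∪ S)
  add-─-add-⊆ mx T E S y∈ with ∈-add⁻ mx T (SubP.p─q⊆p (add mx T) _ y∈)
  ... | inj₁ y∈T  = SubP.x∈p∧x∉q⇒x∈p─q y∈T
                      (x∈p─q⇒x∉q (add mx T) _ y∈ ∘ ∪-lub (SubP.p⊆p∪q (add mx S)) (SubP.q⊆p∪q E _ ∘ ⊆-add mx S))
  ... | inj₂ refl = ⊥-elim (x∈p─q⇒x∉q (add mx T) _ y∈ (SubP.q⊆p∪q E _ (∈-add-just _ S)))

  taken-mono : ∀ (π : Picks m) {t u} → t ℕ.≤ u → taken π t ⊆ taken π u
  taken-mono π = ⊆-chain (taken π) (λ t → ⊆-add (π t) (taken π t))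

  avail-anti : ∀ (π : Picks m) {t u} → t ℕ.≤ u → avail π u ⊆ avail π t
  avail-anti π t≤u = SubP.p⊆q⇒∁p⊇∁q (taken-mono π t≤u)

  ∣taken─∣≤ : ∀ (π : Picks m) k t E → ∣ taken π (k ℕ.+ t) ─ E ∣ ℕ.≤ k ℕ.+ ∣ taken π t ─ E ∣
  ∣taken─∣≤ π zero    t E = ℕP.≤-refl
  ∣taken─∣≤ π (suc k) t E = begin
    ∣ add (π (k ℕ.+ t)) (taken π (k ℕ.+ t)) ─ E ∣
      ≤⟨ SubP.p⊆q⇒∣p∣≤∣q∣ (add-─-⊆ (π (k ℕ.+ t)) (taken π (k ℕ.+ t)) E) ⟩
    ∣ add (π (k ℕ.+ t)) (taken π (k ℕ.+ t) ─ E) ∣   ≤⟨ ∣add∣≤1+∣p∣ (π (k ℕ.+ t)) _ ⟩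
    suc ∣ taken π (k ℕ.+ t) ─ E ∣                   ≤⟨ s≤s (∣taken─∣≤ π k t E) ⟩
    suc k ℕ.+ ∣ taken π t ─ E ∣                     ∎
    where open ℕP.≤-Reasoning

-- A run of the greedy agent

module GreedyRun {m n′ : ℕ} (i : Fin (suc n′)) {f : SetFun m} {I : Subset m → Set} {p : ℚ}
  (normalized : Normalized f) (monotone : Monotone f) (submodular : Submodular f)
  (p-system : IsPSystem p I) (I? : Decidable I)
  (π : Picks m) (greedy : Greedy f I π i) where

  open IndependenceSystem (proj₁ p-system)

  n : ℕ
  n = suc n′

  R : ℕ
  R = rounds {m} {n}

  turn : ℕ → ℕ
  turn = turnOf {m} {n} i

  S : ℕ → Subset m
  S = selectedBy {m} {n} π i

  δ : ℕ → ℚ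
  δ r = f (S (suc r)) - f (S r)

  turn-suc : ∀ r → turn (suc r) ≡ n′ ℕ.+ suc (turn r)
  turn-suc r = trans (cong suc (ℕP.+-assoc n′ (r ℕ.* n) (toℕ i))) (sym (ℕP.+-suc n′ (turn r)))

  turn-mono : ∀ {r s} → r ℕ.≤ s → turn r ℕ.≤ turn s
  turn-mono r≤s = ℕP.+-monoˡ-≤ (toℕ i) (ℕP.*-monoˡ-≤ n r≤s)

  S-mono : ∀ {r s} → r ℕ.≤ s → S r ⊆ S s
  S-mono = ⊆-chain S (λ r → ⊆-add (π (turn r)) (S r))

  S⊆taken : ∀ r → S r ⊆ taken π (turn r)
  S⊆taken zero    = ⊥-elim ∘ SubP.∉⊥
  S⊆taken (suc r) = taken-mono π (ℕP.≤-trans (ℕP.m≤n+m _ n′) (ℕP.≤-reflexive (sym (turn-suc r))))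
                  ∘ add-mono (π (turn r)) (S⊆taken r)

  ∣S∣≤ : ∀ r → ∣ S r ∣ ℕ.≤ r
  ∣S∣≤ zero    = ℕP.≤-reflexive (SubP.∣⊥∣≡0 m)
  ∣S∣≤ (suc r) = ℕP.≤-trans (∣add∣≤1+∣p∣ (π (turn r)) (S r)) (s≤s (∣S∣≤ r))

  S-independent : ∀ r → r ℕ.≤ R → I (S r)
  S-independent zero    _   = empty-indep
  S-independent (suc r) r<R with greedy r r<R
  ... | inj₁ (pass , _)              = subst (λ mx → I (add mx (S r))) (sym pass) (S-independent r (ℕP.<⇒≤ r<R))
  ... | inj₂ (j , pick , _ , iSj , _) = subst (λ mx → I (add mx (S r))) (sym pick) iSj

  greedy-choice : ∀ {r o} → r ℕ.< R → o ∈ avail π (turn r) → I (S r ∪ ⁅ o ⁆) →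
    ∃ λ j → π (turn r) ≡ just j × j ∈ avail π (turn r) × margₑ f o (S r) ≤ margₑ f j (S r)
  greedy-choice {r} {o} r<R o∈Q iSo with greedy r r<R
  ... | inj₁ (_ , stuck)                     = ⊥-elim (stuck o o∈Q iSo)
  ... | inj₂ (j , pick , j∈Q , _ , maximum) = j , pick , j∈Q , maximum o o∈Q iSo

  δ-pick : ∀ r {j} → π (turn r) ≡ just j → δ r ≡ margₑ f j (S r)
  δ-pick r {j} pick = cong (λ X → f X - f (S r))
    (trans (cong (λ mx → add mx (S r)) pick) (SubP.∪-comm (S r) ⁅ j ⁆))

  margₑ≤δ : ∀ {r o} → r ℕ.< R → o ∈ avail π (turn r) → I (S r ∪ ⁅ o ⁆) → margₑ f o (S r) ≤ δ r
  margₑ≤δ {r} r<R o∈Q iSo with j , pick , _ , o≤j ← greedy-choice r<R o∈Q iSo =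
    ℚP.≤-trans o≤j (ℚP.≤-reflexive (sym (δ-pick r pick)))

  δ-nonneg : ∀ r → 0ℚ ≤ δ r
  δ-nonneg r = p≤q⇒0≤q-p (monotone _ _ (⊆-add (π (turn r)) (S r)))

  -- The item picked in round r + 1 was available and addable in round r, when it was worth
  -- at most δ r; by submodularity it is worth even less now.
  δ-suc≤δ : ∀ r → suc r ℕ.< R → δ (suc r) ≤ δ r
  δ-suc≤δ r 1+r<R with greedy (suc r) 1+r<R
  ... | inj₁ (pass , _) = ℚP.≤-trans
    (ℚP.≤-reflexive (trans (cong (λ mx → f (add mx (S (suc r))) - f (S (suc r))) pass)
                           (ℚP.+-inverseʳ (f (S (suc r))))))
    (δ-nonneg r)
  ... | inj₂ (j , pick , j∈Q , iSj , _) = begin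
    δ (suc r)                 ≡⟨ δ-pick (suc r) pick ⟩
    margₑ f j (S (suc r))     ≤⟨ submodular (S r) (S (suc r)) j (S-mono r≤1+r)
                                   (SubP.x∈∁p⇒x∉p j∈Q ∘ S⊆taken (suc r)) ⟩
    margₑ f j (S r)           ≤⟨ margₑ≤δ (ℕP.<-trans (ℕP.n<1+n r) 1+r<R)
                                   (avail-anti π (turn-mono r≤1+r) j∈Q)
                                   (down-closed _ _ (∪-monoˡ-⊆ ⁅ j ⁆ (S-mono r≤1+r)) iSj) ⟩
    δ r                       ∎
    where
    open ℚP.≤-Reasoning
    r≤1+r = ℕP.n≤1+n r

  δ-antitone : ∀ r s → r ℕ.≤ s → s ℕ.< R → δ s ≤ δ r
  δ-antitone r s r≤s s<R with ℕP.m≤n⇒m<n∨m≡n r≤s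
  ... | inj₂ refl = ℚP.≤-refl
  δ-antitone r (suc s) r≤s 1+s<R | inj₁ r<1+s =
    ℚP.≤-trans (δ-suc≤δ s 1+s<R) (δ-antitone r s (ℕP.≤-pred r<1+s) (ℕP.<-trans (ℕP.n<1+n s) 1+s<R))

  prefixSum-δ : prefixSum δ R ≡ f (S R)
  prefixSum-δ = begin
    prefixSum δ R        ≡⟨ prefixSum-telescope (f ∘ S) R ⟩
    f (S R) - f ⊥        ≡⟨ cong (f (S R) -_) normalized ⟩
    f (S R) - 0ℚ         ≡⟨ solve 1 (λ a → a :- con 0ℚ := a) refl (f (S R)) ⟩
    f (S R)              ∎
    where open ≡-Reasoning

  othersTaken : ℕ → Subset m
  othersTaken r = taken π (turn r) ─ (taken π (toℕ i) ∪ S r)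

  -- Between two consecutive turns of agent i the other n′ agents take at most one item each.
  ∣othersTaken∣≤ : ∀ r → ∣ othersTaken r ∣ ℕ.≤ n′ ℕ.* r
  ∣othersTaken∣≤ zero =
    ℕP.≤-trans (ℕP.≤-reflexive (trans (cong ∣_∣ (SubP.Empty-unique nothing-yet)) (SubP.∣⊥∣≡0 m))) z≤n
    where
    nothing-yet : Empty (othersTaken zero)
    nothing-yet (x , x∈) = x∈p─q⇒x∉q (taken π (toℕ i)) _ x∈ (SubP.p⊆p∪q (S zero) (SubP.p─q⊆p _ _ x∈))
  ∣othersTaken∣≤ (suc r) = begin
    ∣ othersTaken (suc r) ∣                          ≡⟨ cong (λ t → ∣ taken π t ─ E ∣) (turn-suc r) ⟩
    ∣ taken π (n′ ℕ.+ suc (turn r)) ─ E ∣            ≤⟨ ∣taken─∣≤ π n′ (suc (turn r)) E ⟩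
    n′ ℕ.+ ∣ taken π (suc (turn r)) ─ E ∣
      ≤⟨ ℕP.+-monoʳ-≤ n′ (SubP.p⊆q⇒∣p∣≤∣q∣ (add-─-add-⊆ (π (turn r)) (taken π (turn r)) (taken π (toℕ i)) (S r))) ⟩
    n′ ℕ.+ ∣ othersTaken r ∣                         ≤⟨ ℕP.+-monoʳ-≤ n′ (∣othersTaken∣≤ r) ⟩
    n′ ℕ.+ n′ ℕ.* r                                  ≡⟨ ℕP.*-suc n′ r ⟨
    n′ ℕ.* suc r                                     ∎
    where
    open ℕP.≤-Reasoning
    E = taken π (toℕ i) ∪ S (suc r)

  StillOpen : Set
  StillOpen = ∃ λ z → z ∈ avail π (turn R) × I (S R ∪ ⁅ z ⁆)

  stillOpen? : Dec StillOpen
  stillOpen? = FinP.any? λ z → (z SubP.∈? avail π (turn R)) ×-dec I? (S R ∪ ⁅ z ⁆)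

  -- An item still open at the end was open in every round, so agent i never passed.
  stillOpen⇒r≤∣S∣ : StillOpen → ∀ r → r ℕ.≤ R → r ℕ.≤ ∣ S r ∣
  stillOpen⇒r≤∣S∣ _ zero _ = z≤n
  stillOpen⇒r≤∣S∣ still@(z , z∈Q , iSz) (suc r) r<R
    with j , pick , j∈Q , _ ← greedy-choice r<R (avail-anti π (turn-mono (ℕP.<⇒≤ r<R)) z∈Q)
                                (down-closed _ _ (∪-monoˡ-⊆ ⁅ z ⁆ (S-mono (ℕP.<⇒≤ r<R))) iSz)
    = ℕP.≤-trans (s≤s (stillOpen⇒r≤∣S∣ still r (ℕP.<⇒≤ r<R)))
        (ℕP.≤-trans (x∉p⇒∣p∣<∣p∪⁅x⁆∣ (S r) (SubP.x∈∁p⇒x∉p j∈Q ∘ S⊆taken r))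
                    (ℕP.≤-reflexive (cong (λ mx → ∣ add mx (S r) ∣) (sym pick))))

  stillOpen⇒∣∁S∣≤ : StillOpen → ∣ ∁ (S R) ∣ ℕ.≤ n′ ℕ.* R
  stillOpen⇒∣∁S∣≤ still = begin
    ∣ ∁ (S R) ∣          ≡⟨ SubP.∣∁p∣≡n∸∣p∣ (S R) ⟩
    m ℕ.∸ ∣ S R ∣        ≤⟨ ℕP.∸-monoʳ-≤ m (stillOpen⇒r≤∣S∣ still R ℕP.≤-refl) ⟩
    m ℕ.∸ R              ≤⟨ ℕP.m≤n+o⇒m∸n≤o m R (ℕP.≤-trans (m≤⌈m/n⌉*n m n′)
                              (ℕP.≤-reflexive (trans (ℕP.*-suc R n′) (cong (R ℕ.+_) (ℕP.*-comm R n′))))) ⟩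
    n′ ℕ.* R             ∎
    where open ℕP.≤-Reasoning

  degenerate-bound : ¬ (0ℚ ≤ p) → ∀ {O} → I O → f O ≤ (ℕtoℚ n + p) * f (S R)
  degenerate-bound 0≰p iO
    rewrite p-system-degenerate p p-system 0≰p iO
          | p-system-degenerate p p-system 0≰p (S-independent R ℕP.≤-refl)
          | normalized
    = ℚP.≤-reflexive (sym (ℚP.*-zeroʳ (ℕtoℚ n + p)))

  module Charging (O : Subset m) (iO : I O) (O⊆Mᵢ : O ⊆ Mᵢ {m} {n} π i) (0≤p : 0ℚ ≤ p) where

    K : ℚ
    K = ℕtoℚ n′ + p

    -- Nothing is open at t = R, so closed R is O ∖ S R.
    Open : ℕ → Fin m → Set
    Open t o = t ℕ.< R × o ∈ avail π (turn t) × I (S t ∪ ⁅ o ⁆)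

    open? : ∀ t o → Dec (Open t o)
    open? t o = (t ℕ.<? R) ×-dec ((o SubP.∈? avail π (turn t)) ×-dec I? (S t ∪ ⁅ o ⁆))

    Closed : ℕ → Fin m → Set
    Closed t o = o ∈ O × o ∉ S R × ¬ Open t o

    closed? : ∀ t → Decidable (Closed t)
    closed? t o = (o SubP.∈? O) ×-dec (¬? (o SubP.∈? S R) ×-dec ¬? (open? t o))

    closed : ℕ → Subset m
    closed t = filterSubset (closed? t)

    closed⁺ : ∀ {t o} → Closed t o → o ∈ closed t
    closed⁺ {t} = ∈-filterSubset⁺ (closed? t)

    closed⁻ : ∀ {t o} → o ∈ closed t → Closed t o
    closed⁻ {t} = ∈-filterSubset⁻ (closed? t)

    closed-zero : closed 0 ≡ ⊥
    closed-zero = SubP.Empty-unique λ (o , o∈) → let (o∈O , _ , ¬open) = closed⁻ o∈ in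
      ¬open (0<R o , O⊆Mᵢ o∈O , down-closed O _ (∪-lub (⊥-elim ∘ SubP.∉⊥) (x∈p⇒⁅x⁆⊆p o∈O)) iO)
      where
      0<R : Fin m → 0 ℕ.< R
      0<R o = ℕP.n≢0⇒n>0 λ R≡0 → ℕP.n≮0
        (ℕP.<-≤-trans (FinP.toℕ<n o) (ℕP.≤-trans (m≤⌈m/n⌉*n m n′) (ℕP.≤-reflexive (cong (ℕ._* n) R≡0))))

    closed-mono : ∀ t → closed t ⊆ closed (suc t)
    closed-mono t {o} o∈ = let (o∈O , o∉S , ¬open) = closed⁻ o∈ in
      closed⁺ (o∈O , o∉S , λ (1+t<R , o∈Q , iSo) → ¬open
        (ℕP.<-trans (ℕP.n<1+n t) 1+t<R , avail-anti π (turn-mono (ℕP.n≤1+n t)) o∈Q ,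
         down-closed _ _ (∪-monoˡ-⊆ ⁅ o ⁆ (S-mono (ℕP.n≤1+n t))) iSo))

    v : Fin m → ℚ
    v o = margₑ f o (S R)

    newly-closed-value : ∀ t → t ℕ.< R → ∀ {o} → o ∈ closed (suc t) ─ closed t → v o ≤ δ t
    newly-closed-value t t<R {o} o∈ with closed⁻ (SubP.p─q⊆p _ _ o∈) | open? t o
    ... | o∈O , o∉S , _ | no ¬open = ⊥-elim (x∈p─q⇒x∉q _ (closed t) o∈ (closed⁺ (o∈O , o∉S , ¬open)))
    ... | _ , o∉S , _   | yes (_ , o∈Q , iSo) =
      ℚP.≤-trans (submodular (S t) (S R) o (S-mono (ℕP.<⇒≤ t<R)) o∉S) (margₑ≤δ t<R o∈Q iSo)

    Blocked : ℕ → Fin m → Set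
    Blocked t o = o ∈ O × ¬ I (S t ∪ ⁅ o ⁆)

    blocked? : ∀ t → Decidable (Blocked t)
    blocked? t o = (o SubP.∈? O) ×-dec ¬? (I? (S t ∪ ⁅ o ⁆))

    blocked : ℕ → Subset m
    blocked t = filterSubset (blocked? t)

    ∣blocked∣≤ : ∀ t → t ℕ.≤ R → ℕtoℚ ∣ blocked t ∣ ≤ p * ℕtoℚ t
    ∣blocked∣≤ t t≤R = ℚP.≤-trans
      (p-system-bound p p-system I? (S-independent t t≤R)
        (down-closed O _ (proj₁ ∘ ∈-filterSubset⁻ (blocked? t)) iO) (proj₂ ∘ ∈-filterSubset⁻ (blocked? t)))
      (*-monoˡ-≤-0≤ 0≤p (ℕtoℚ-mono-≤ (∣S∣≤ t)))

    closed⊆others∪blocked : ∀ t → t ℕ.≤ R → (t ≡ R → ¬ StillOpen) → closed t ⊆ othersTaken t ∪ blocked t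
    closed⊆others∪blocked t t≤R not-open {o} o∈ with closed⁻ o∈
    ... | o∈O , o∉S , ¬open with I? (S t ∪ ⁅ o ⁆) | o SubP.∈? avail π (turn t) | ℕP.m≤n⇒m<n∨m≡n t≤R
    ...   | no ¬iSo | _ | _ = SubP.q⊆p∪q _ _ (∈-filterSubset⁺ (blocked? t) (o∈O , ¬iSo))
    ...   | yes _ | no o∉Q | _ = SubP.p⊆p∪q _ (SubP.x∈p∧x∉q⇒x∈p─q (SubP.x∉∁p⇒x∈p o∉Q)
            ([ SubP.x∈∁p⇒x∉p (O⊆Mᵢ o∈O) , o∉S ∘ S-mono t≤R ] ∘ SubP.x∈p∪q⁻ _ _))
    ...   | yes iSo | yes o∈Q | inj₁ t<R = ⊥-elim (¬open (t<R , o∈Q , iSo))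
    ...   | yes iSo | yes o∈Q | inj₂ refl = ⊥-elim (not-open refl (o , o∈Q , iSo))

    count-bound : ∀ {d a b t} → d ℕ.≤ a ℕ.+ b → a ℕ.≤ n′ ℕ.* t → ℕtoℚ b ≤ p * ℕtoℚ t → ℕtoℚ d ≤ K * ℕtoℚ t
    count-bound {d} {a} {b} {t} d≤a+b a≤ b≤ = begin
      ℕtoℚ d                         ≤⟨ ℕtoℚ-mono-≤ d≤a+b ⟩
      ℕtoℚ (a ℕ.+ b)                 ≡⟨ ℕtoℚ-+ a b ⟩
      ℕtoℚ a + ℕtoℚ b                ≤⟨ ℚP.+-mono-≤ (ℕtoℚ-mono-≤ a≤) b≤ ⟩
      ℕtoℚ (n′ ℕ.* t) + p * ℕtoℚ t   ≡⟨ cong (_+ p * ℕtoℚ t) (ℕtoℚ-* n′ t) ⟩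
      ℕtoℚ n′ * ℕtoℚ t + p * ℕtoℚ t  ≡⟨ ℚP.*-distribʳ-+ (ℕtoℚ t) (ℕtoℚ n′) p ⟨
      K * ℕtoℚ t                     ∎
      where open ℚP.≤-Reasoning

    ∣closed∣≤-by-cover : ∀ t → t ℕ.≤ R → (t ≡ R → ¬ StillOpen) → ℕtoℚ ∣ closed t ∣ ≤ K * ℕtoℚ t
    ∣closed∣≤-by-cover t t≤R not-open = count-bound
      (ℕP.≤-trans (SubP.p⊆q⇒∣p∣≤∣q∣ (closed⊆others∪blocked t t≤R not-open))
                  (∣p∪q∣≤∣p∣+∣q∣ (othersTaken t) (blocked t)))
      (∣othersTaken∣≤ t) (∣blocked∣≤ t t≤R)

    ∣closed∣≤ : ∀ t → t ℕ.≤ R → ℕtoℚ ∣ closed t ∣ ≤ K * ℕtoℚ t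
    ∣closed∣≤ t t≤R with ℕP.m≤n⇒m<n∨m≡n t≤R
    ... | inj₁ t<R  = ∣closed∣≤-by-cover t t≤R λ t≡R → ⊥-elim (ℕP.<-irrefl t≡R t<R)
    ... | inj₂ refl with stillOpen?
    ...   | no ¬still = ∣closed∣≤-by-cover t t≤R λ _ → ¬still
    ...   | yes still = count-bound {a = ∣ ∁ (S R) ∣} {b = 0}
      (ℕP.≤-trans (SubP.p⊆q⇒∣p∣≤∣q∣ (SubP.x∉p⇒x∈∁p ∘ proj₁ ∘ proj₂ ∘ closed⁻)) (ℕP.m≤m+n _ 0))
      (stillOpen⇒∣∁S∣≤ still)
      (ℚP.≤-trans (ℚP.≤-reflexive (sym (ℚP.*-zeroʳ p))) (*-monoˡ-≤-0≤ 0≤p (ℕtoℚ-mono-≤ {b = R} z≤n)))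

    approximation : f O ≤ (ℕtoℚ n + p) * f (S R)
    approximation = begin
      f O                                  ≤⟨ monotone O (closed R ∪ S R) O⊆closed∪S ⟩
      f (closed R ∪ S R)
        ≤⟨ submodular-∪-bound {f = f} submodular (closed R) (S R) (proj₁ ∘ proj₂ ∘ closed⁻) ⟩
      f (S R) + sumOver (closed R) v       ≤⟨ ℚP.+-monoʳ-≤ (f (S R)) charge ⟩
      f (S R) + K * prefixSum δ R          ≡⟨ cong (λ x → f (S R) + K * x) prefixSum-δ ⟩
      f (S R) + (ℕtoℚ n′ + p) * f (S R)
        ≡⟨ solve 3 (λ a b c → a :+ (b :+ c) :* a := ((con 1ℚ :+ b) :+ c) :* a) refl (f (S R)) (ℕtoℚ n′) p ⟩
      ((1ℚ + ℕtoℚ n′) + p) * f (S R)       ≡⟨ cong (λ x → (x + p) * f (S R)) (ℕtoℚ-suc n′) ⟨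
      (ℕtoℚ n + p) * f (S R)               ∎
      where
      open ℚP.≤-Reasoning
      O⊆closed∪S : O ⊆ closed R ∪ S R
      O⊆closed∪S {o} o∈O with o SubP.∈? S R
      ... | yes o∈S = SubP.q⊆p∪q _ (S R) o∈S
      ... | no o∉S  = SubP.p⊆p∪q (S R) (closed⁺ (o∈O , o∉S , ℕP.<-irrefl refl ∘ proj₁))
      charge : sumOver (closed R) v ≤ K * prefixSum δ R
      charge = abel-bound R K (λ t → sumOver (closed t) v) (λ t → ℕtoℚ ∣ closed t ∣) δ
        (trans (cong (λ X → sumOver X v) closed-zero) (sumOver-⊥ v))
        (cong ℕtoℚ (trans (cong ∣_∣ closed-zero) (SubP.∣⊥∣≡0 m)))
        (λ t t<R → sumOver-⊆-bound (closed t) (closed (suc t)) v (δ t) (closed-mono t) (newly-closed-value t t<R))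
        ∣closed∣≤ δ-antitone (λ t _ → δ-nonneg t)

theorem2 : (m n : ℕ) .{{_ : NonZero n}} (i : Fin n)
    (f : SetFun m) (I : Subset m → Set) (p : ℚ) →
    Normalized f → Nonnegative f → Monotone f → Submodular f →
    IsPSystem p I →
    (π : Picks m) →
    Legal π (totalTurns {m} {n}) →
    Greedy f I π i →
    ∀ (S : Subset m) → I S → S ⊆ Mᵢ π i →
    f S ℚ.≤ (ℕtoℚ n ℚ.+ p) ℚ.* f (finalSet π i)
theorem2 m (suc n′) i f I p normalized _ monotone submodular p-system π _ greedy O iO O⊆Mᵢ =
  decidable-stable (f O ≤? (ℕtoℚ (suc n′) + p) * f (finalSet π i))
    λ ≰ → ¬¬-decidable I λ I? → ≰ (bound I? (0ℚ ≤? p))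
  where
  module Run (I? : Decidable I) = GreedyRun i {p = p} normalized monotone submodular p-system I? π greedy
  bound : Decidable I → Dec (0ℚ ≤ p) → f O ≤ (ℕtoℚ (suc n′) + p) * f (finalSet π i)
  bound I? (yes 0≤p) = Run.Charging.approximation I? O iO O⊆Mᵢ 0≤p
  bound I? (no 0≰p)  = Run.degenerate-bound I? 0≰p iO
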